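{- Let $\Delta \ge 3$ be a fixed integer. If $G$ is a graph of order $n$ obtained from a subdivided star $T_k$, where $2 \le k \le \Delta$, by adding an edge $e$ in such a way that $G = T_k + e$ contains no $4$-cycle and satisfies $\Delta(G) \le \Delta$, then \[ \gamma^{\mathrm{IOC}}(G) \le \left( \frac{2\Delta - 1}{2\Delta} \right) n. \]
   Context: For a graph $G$, a set $S\subseteq V(G)$ is an identifying open code (IO-code) if every vertex has a neighbor in $S$ and $N_G(u)\cap S \ne N_G(v)\cap S$ for all distinct vertices $u,v$, where $N_G(v)$ is the open neighborhood; $\gamma^{\mathrm{IOC}}(G)$ is the minimum cardinality of an IO-code. The subdivided star $T_k$ is the tree obtained from the star $K_{1,k}$ by subdividing every edge exactly once (order $2k+1$). -}

module Defs where

open import Data.Bool using (Bool; true; false; _∧_; _∨_)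
open import Data.Nat using (ℕ; zero; suc; _+_; _≡ᵇ_; _≤ᵇ_)
open import Data.Fin using (Fin; toℕ; _≟_)
open import Data.Fin.Subset using (Subset; _∩_; Nonempty)
open import Data.Vec using (tabulate)
open import Data.Product using (_×_)
open import Relation.Nullary using (¬_)
open import Relation.Nullary.Decidable using (⌊_⌋)
open import Relation.Binary.PropositionalEquality using (_≡_; _≢_)

Graph : ℕ → Set
Graph n = Fin n → Fin n → Bool

Adj : ∀ {n} → Graph n → Fin n → Fin n → Set
Adj G u v = G u v ≡ true

N : ∀ {n} → Graph n → Fin n → Subset n
N G v = tabulate (G v)

IsIOCode : ∀ {n} → Graph n → Subset n → Set
IsIOCode {n} G S =
  ((v : Fin n) → Nonempty (N G v ∩ S)) ×
  ((u v : Fin n) → u ≢ v → N G u ∩ S ≢ N G v ∩ S)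

-- Subdivided star T_k on the vertex set Fin (2k+1):
-- vertex 0 is the centre, vertices 1..k are the subdivision vertices,
-- and vertex k+i is the leaf attached to vertex i (1 ≤ i ≤ k).
private
  starEdge : ℕ → ℕ → ℕ → Bool
  starEdge k a b =
    ((a ≡ᵇ 0) ∧ (1 ≤ᵇ b) ∧ (b ≤ᵇ k)) ∨
    ((1 ≤ᵇ a) ∧ (a ≤ᵇ k) ∧ (b ≡ᵇ (k + a)))

subdividedStar : (k : ℕ) → Graph (suc (k + k))
subdividedStar k u v = starEdge k (toℕ u) (toℕ v) ∨ starEdge k (toℕ v) (toℕ u)

addEdge : ∀ {n} → Graph n → Fin n → Fin n → Graph n
addEdge G x y u v =
  G u v ∨ (⌊ u ≟ x ⌋ ∧ ⌊ v ≟ y ⌋) ∨ (⌊ u ≟ y ⌋ ∧ ⌊ v ≟ x ⌋)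

C4Free : ∀ {n} → Graph n → Set
C4Free {n} G = (a b c d : Fin n) →
  a ≢ b → a ≢ c → a ≢ d → b ≢ c → b ≢ d → c ≢ d →
  ¬ (Adj G a b × Adj G b c × Adj G c d × Adj G d a)

-- In a C4-free graph two distinct vertices have at most one common neighbour. Hence S is an
-- identifying open code as soon as every vertex v is assigned two (possibly equal) neighbours in S
-- that together determine v: if N(u) ∩ S = N(v) ∩ S, the witnesses of u and v must coincide, since
-- differing ones would close a 4-cycle. In T_k + e the set V − {centre} admits such witnesses, which
-- suffices when k < Δ because then n = 2k + 1 ≤ 2Δ. When k = Δ the centre has no spare degree, and an
-- edge from a spoke to the leaf of another spoke closes a 4-cycle, so e joins two spokes or two
-- leaves; in both cases a set missing two vertices admits witnesses, and n ≤ 4Δ gives the bound.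
module Submission where

open import Defs
open import Data.Bool using (Bool; true; false; _∧_; _∨_)
open import Data.Bool.Properties using (∨-comm; ∧-comm; ∨-zeroʳ; ¬-not; T-≡)
open import Data.Fin using (Fin; zero; suc; toℕ; _↑ˡ_; _↑ʳ_; splitAt; join; punchIn; punchOut; _≟_)
open import Data.Fin.Properties
  using (toℕ<n; toℕ-↑ˡ; toℕ-↑ʳ; splitAt-↑ˡ; splitAt-↑ʳ; join-splitAt; 0≢1+n; suc-injective;
         punchInᵢ≢i; punchIn-injective; punchIn-punchOut)
open import Data.Fin.Subset using (Subset; ⊤; _-_; _∩_; _∈_; ∣_∣)
open import Data.Fin.Subset.Properties
  using (∈⊤; ∣⊤∣≡n; x∈p∩q⁺; x∈p∩q⁻; x∈p∧x≢y⇒x∈p-y; x∈p⇒∣p-x∣<∣p∣)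
open import Data.Nat using (ℕ; zero; suc; _+_; _*_; _∸_; _≤_; _<_; _<ᵇ_; _≤ᵇ_; _≡ᵇ_; z≤n; s≤s; _<?_)
open import Data.Nat.Properties
  using (≤-trans; ≤-<-trans; <⇒≤; <⇒≢; ≮⇒≥; n≮n; m<n+m; m+n≮m; m≤m+n; +-comm; +-suc;
         +-mono-≤; +-monoʳ-≤; *-monoʳ-≤; *-distribˡ-+; *-distribʳ-∸; *-identityˡ; m+n≤o⇒m≤o∸n;
         <⇒<ᵇ; <ᵇ⇒<; ≡⇒≡ᵇ; ≡ᵇ⇒≡; module ≤-Reasoning)
open import Data.Nat.Tactic.RingSolver using (solve-∀)
open import Data.Empty using (⊥)
open import Data.Product using (Σ; ∃; _×_; _,_; proj₁; proj₂)
open import Data.Sum using (inj₁; inj₂; [_,_]′)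
open import Data.Vec.Properties using (lookup∘tabulate; lookup⇒[]=; []=⇒lookup)
open import Function using (_∘_)
open import Function.Bundles using (Equivalence)
open import Function.Definitions using (Injective)
open import Relation.Nullary using (¬_; yes; no; contradiction)
open import Relation.Nullary.Decidable using (⌊_⌋)
open import Relation.Binary.PropositionalEquality

private
  variable
    m n : ℕ

<ᵇ-true : ∀ {a b} → a < b → (a <ᵇ b) ≡ true
<ᵇ-true a<b = Equivalence.to T-≡ (<⇒<ᵇ a<b)

<ᵇ-false : ∀ {a b} → ¬ a < b → (a <ᵇ b) ≡ false
<ᵇ-false {a} {b} a≮b = ¬-not (a≮b ∘ <ᵇ⇒< a b ∘ Equivalence.from T-≡)

≡ᵇ-true : ∀ {a b} → a ≡ b → (a ≡ᵇ b) ≡ true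
≡ᵇ-true {a} {b} a≡b = Equivalence.to T-≡ (≡⇒≡ᵇ a b a≡b)

≡ᵇ-false : ∀ {a b} → a ≢ b → (a ≡ᵇ b) ≡ false
≡ᵇ-false {a} {b} a≢b = ¬-not (a≢b ∘ ≡ᵇ⇒≡ a b ∘ Equivalence.from T-≡)

Undirected : Graph n → Set
Undirected G = ∀ u v → G u v ≡ G v u

Loopless : Graph n → Set
Loopless G = ∀ v → G v v ≡ false

module _ {G : Graph n} where

  adj-sym : Undirected G → ∀ {u v} → Adj G u v → Adj G v u
  adj-sym undirected {u} {v} uv = trans (undirected v u) uv

  adj⇒≢ : Loopless G → ∀ {u v} → Adj G u v → u ≢ v
  adj⇒≢ loopless {u} uu refl = contradiction (trans (sym (loopless u)) uu) λ ()

  C4Free⇒¬square : Loopless G → C4Free G → ∀ {a b c d} → a ≢ c → b ≢ d →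
    Adj G a b → Adj G b c → Adj G c d → Adj G d a → ⊥
  C4Free⇒¬square loopless c4 a≢c b≢d ab bc cd da =
    c4 _ _ _ _ (adj⇒≢ loopless ab) a≢c (adj⇒≢ loopless da ∘ sym) (adj⇒≢ loopless bc) b≢d
      (adj⇒≢ loopless cd) (ab , bc , cd , da)

  ∈N⁺ : ∀ {v w} → Adj G v w → w ∈ N G v
  ∈N⁺ {v} {w} vw = lookup⇒[]= w (N G v) (trans (lookup∘tabulate (G v) w) vw)

  ∈N⁻ : ∀ {v w} → w ∈ N G v → Adj G v w
  ∈N⁻ {v} {w} w∈N = trans (sym (lookup∘tabulate (G v) w)) ([]=⇒lookup w∈N)

  ∈N∩⁺ : ∀ {S v w} → Adj G v w → w ∈ S → w ∈ N G v ∩ S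
  ∈N∩⁺ vw w∈S = x∈p∩q⁺ (∈N⁺ vw , w∈S)

  ∈N∩⁻ : ∀ {S v w} → w ∈ N G v ∩ S → Adj G v w
  ∈N∩⁻ = ∈N⁻ ∘ proj₁ ∘ x∈p∩q⁻ _ _

  -- If N(u) ∩ S = N(v) ∩ S but the witnesses r u and r v differ, then u, r v, v, r u is a 4-cycle.
  pairedWitnesses⇒IsIOCode : Undirected G → Loopless G → C4Free G → ∀ {S} (p q : Fin n → Fin n) →
    (∀ v → p v ∈ N G v ∩ S) → (∀ v → q v ∈ N G v ∩ S) →
    (∀ {u v} → p u ≡ p v → q u ≡ q v → u ≡ v) → IsIOCode G S
  pairedWitnesses⇒IsIOCode undirected loopless c4 {S} p q p∈ q∈ injective =
    (λ v → p v , p∈ v) , separated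
    where
    separatedBy : (r : Fin n → Fin n) → (∀ v → r v ∈ N G v ∩ S) →
      ∀ {u v} → u ≢ v → r u ≢ r v → N G u ∩ S ≢ N G v ∩ S
    separatedBy r r∈ {u} {v} u≢v ru≢rv same =
      C4Free⇒¬square loopless c4 u≢v (ru≢rv ∘ sym)
        (∈N∩⁻ (subst (r v ∈_) (sym same) (r∈ v))) (adj-sym undirected (∈N∩⁻ (r∈ v)))
        (∈N∩⁻ (subst (r u ∈_) same (r∈ u))) (adj-sym undirected (∈N∩⁻ (r∈ u)))

    separated : ∀ u v → u ≢ v → N G u ∩ S ≢ N G v ∩ S
    separated u v u≢v with p u ≟ p v | q u ≟ q v
    ... | yes pu≡pv | yes qu≡qv = λ _ → u≢v (injective pu≡pv qu≡qv)
    ... | no pu≢pv  | _         = separatedBy p p∈ u≢v pu≢pv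
    ... | _         | no qu≢qv  = separatedBy q q∈ u≢v qu≢qv

module _ {G : Graph n} {x y : Fin n} where

  addEdge-undirected : Undirected G → Undirected (addEdge G x y)
  addEdge-undirected undirected u v =
    cong₂ _∨_ (undirected u v)
      (trans (∨-comm (⌊ u ≟ x ⌋ ∧ ⌊ v ≟ y ⌋) (⌊ u ≟ y ⌋ ∧ ⌊ v ≟ x ⌋))
             (cong₂ _∨_ (∧-comm ⌊ u ≟ y ⌋ ⌊ v ≟ x ⌋) (∧-comm ⌊ u ≟ x ⌋ ⌊ v ≟ y ⌋)))

  addEdge-loopless : Loopless G → x ≢ y → Loopless (addEdge G x y)
  addEdge-loopless loopless x≢y v rewrite loopless v with v ≟ x | v ≟ y
  ... | yes refl | yes refl = contradiction refl x≢y
  ... | yes _    | no _     = refl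
  ... | no _     | yes _    = refl
  ... | no _     | no _     = refl

  addEdge-⊇ : ∀ {u v} → Adj G u v → Adj (addEdge G x y) u v
  addEdge-⊇ uv = cong (_∨ _) uv

  addEdge-new : Adj (addEdge G x y) x y
  addEdge-new with x ≟ x | y ≟ y
  ... | yes _ | yes _ = ∨-zeroʳ (G x y)
  ... | no x≢x | _    = contradiction refl x≢x
  ... | _ | no y≢y    = contradiction refl y≢y

injection⇒≤∣p∣ : ∀ {p : Subset n} (f : Fin m → Fin n) → Injective _≡_ _≡_ f →
  (∀ i → f i ∈ p) → m ≤ ∣ p ∣
injection⇒≤∣p∣ {m = zero}  f _ _ = z≤n
injection⇒≤∣p∣ {m = suc m} f f-injective f∈p =
  ≤-<-trans (injection⇒≤∣p∣ (f ∘ suc) (suc-injective ∘ f-injective)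
              (λ i → x∈p∧x≢y⇒x∈p-y (f∈p (suc i)) (0≢1+n ∘ sym ∘ f-injective)))
            (x∈p⇒∣p-x∣<∣p∣ (f∈p zero))

∣⊤-x∣<n : (x : Fin n) → ∣ ⊤ - x ∣ < n
∣⊤-x∣<n {n} x = subst (∣ ⊤ - x ∣ <_) (∣⊤∣≡n n) (x∈p⇒∣p-x∣<∣p∣ (∈⊤ {x = x}))

∣⊤-x-y∣+2≤n : {x y : Fin n} → x ≢ y → 2 + ∣ ⊤ - x - y ∣ ≤ n
∣⊤-x-y∣+2≤n {x = x} x≢y = ≤-trans (s≤s (x∈p⇒∣p-x∣<∣p∣ (x∈p∧x≢y⇒x∈p-y ∈⊤ (x≢y ∘ sym)))) (∣⊤-x∣<n x)

-- punchIn i avoids i, and the inner punchIn avoids the preimage of j.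
avoid-two : 3 ≤ n → (i j : Fin n) → i ≢ j → ∃ λ l → l ≢ i × l ≢ j
avoid-two (s≤s (s≤s (s≤s _))) i j i≢j =
  punchIn i (punchIn j′ zero) , punchInᵢ≢i i _ ,
  λ l≡j → punchInᵢ≢i j′ zero (punchIn-injective i _ _ (trans l≡j (sym (punchIn-punchOut i≢j))))
  where j′ = punchOut i≢j

distinct-pair : 2 ≤ n → Σ (Fin n) λ i → Σ (Fin n) λ j → i ≢ j
distinct-pair (s≤s (s≤s _)) = zero , suc zero , λ ()

deficiency-bound : ∀ {Δ c} → m + c ≤ n → n ≤ 2 * Δ * m → 2 * Δ * c ≤ (2 * Δ ∸ 1) * n
deficiency-bound {m} {n} {Δ} {c} m+c≤n n≤2Δm = begin
  2 * Δ * c          ≤⟨ m+n≤o⇒m≤o∸n (2 * Δ * c) room ⟩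
  2 * Δ * n ∸ n      ≡⟨ cong (2 * Δ * n ∸_) (sym (*-identityˡ n)) ⟩
  2 * Δ * n ∸ 1 * n  ≡⟨ sym (*-distribʳ-∸ n (2 * Δ) 1) ⟩
  (2 * Δ ∸ 1) * n    ∎
  where
  open ≤-Reasoning
  room : 2 * Δ * c + n ≤ 2 * Δ * n
  room = begin
    2 * Δ * c + n          ≤⟨ +-monoʳ-≤ (2 * Δ * c) n≤2Δm ⟩
    2 * Δ * c + 2 * Δ * m  ≡⟨ sym (*-distribˡ-+ (2 * Δ) c m) ⟩
    2 * Δ * (c + m)        ≤⟨ *-monoʳ-≤ (2 * Δ) (subst (_≤ n) (+-comm m c) m+c≤n) ⟩
    2 * Δ * n              ∎

module SubdividedStar (k : ℕ) where

  data Vertex : Set where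
    centre : Vertex
    spoke leaf : Fin k → Vertex

  spoke-injective : ∀ {i j} → spoke i ≡ spoke j → i ≡ j
  spoke-injective refl = refl

  leaf-injective : ∀ {i j} → leaf i ≡ leaf j → i ≡ j
  leaf-injective refl = refl

  ⌜_⌝ : Vertex → Fin (suc (k + k))
  ⌜ centre ⌝  = zero
  ⌜ spoke i ⌝ = suc (i ↑ˡ k)
  ⌜ leaf i ⌝  = suc (k ↑ʳ i)

  label : Fin (suc (k + k)) → Vertex
  label zero    = centre
  label (suc v) = [ spoke , leaf ]′ (splitAt k v)

  label-⌜⌝ : ∀ a → label ⌜ a ⌝ ≡ a
  label-⌜⌝ centre    = refl
  label-⌜⌝ (spoke i) = cong [ spoke , leaf ]′ (splitAt-↑ˡ k i k)
  label-⌜⌝ (leaf i)  = cong [ spoke , leaf ]′ (splitAt-↑ʳ k k i)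

  ⌜label⌝ : ∀ v → ⌜ label v ⌝ ≡ v
  ⌜label⌝ zero    = refl
  ⌜label⌝ (suc v) = trans (⌜⌝∘[spoke,leaf] (splitAt k v)) (cong suc (join-splitAt k k v))
    where
    ⌜⌝∘[spoke,leaf] : ∀ s → ⌜ [ spoke , leaf ]′ s ⌝ ≡ suc (join k k s)
    ⌜⌝∘[spoke,leaf] (inj₁ i) = refl
    ⌜⌝∘[spoke,leaf] (inj₂ i) = refl

  ⌜⌝-injective : ∀ {a b} → ⌜ a ⌝ ≡ ⌜ b ⌝ → a ≡ b
  ⌜⌝-injective {a} {b} eq = trans (sym (label-⌜⌝ a)) (trans (cong label eq) (label-⌜⌝ b))

  data Labelled : Fin (suc (k + k)) → Set where
    vertex : (a : Vertex) → Labelled ⌜ a ⌝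

  labelled : ∀ v → Labelled v
  labelled v = subst Labelled (⌜label⌝ v) (vertex (label v))

  -- The private edge test of Defs, restated so that the two halves of subdividedStar can be named.
  starEdge′ : ℕ → ℕ → Bool
  starEdge′ a b =
    ((a ≡ᵇ 0) ∧ (1 ≤ᵇ b) ∧ (b ≤ᵇ k)) ∨
    ((1 ≤ᵇ a) ∧ (a ≤ᵇ k) ∧ (b ≡ᵇ (k + a)))

  star-undirected : Undirected (subdividedStar k)
  star-undirected u v = ∨-comm (starEdge′ (toℕ u) (toℕ v)) (starEdge′ (toℕ v) (toℕ u))

  star-loopless : Loopless (subdividedStar k)
  star-loopless v with labelled v
  ... | vertex centre = refl
  ... | vertex (spoke i)
    rewrite toℕ-↑ˡ i k | <ᵇ-true (toℕ<n i)
          | ≡ᵇ-false (<⇒≢ (m<n+m (suc (toℕ i)) (≤-<-trans z≤n (toℕ<n i)))) = refl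
  ... | vertex (leaf i) rewrite toℕ-↑ʳ k i | <ᵇ-false (m+n≮m k (toℕ i)) = refl

  star-centre-spoke : ∀ i → Adj (subdividedStar k) ⌜ centre ⌝ ⌜ spoke i ⌝
  star-centre-spoke i rewrite toℕ-↑ˡ i k | <ᵇ-true (toℕ<n i) = refl

  star-spoke-leaf : ∀ i → Adj (subdividedStar k) ⌜ spoke i ⌝ ⌜ leaf i ⌝
  star-spoke-leaf i rewrite toℕ-↑ˡ i k | toℕ-↑ʳ k i | <ᵇ-true (toℕ<n i)
                          | ≡ᵇ-true (sym (+-suc k (toℕ i))) = refl

  star-spoke-centre : ∀ i → Adj (subdividedStar k) ⌜ spoke i ⌝ ⌜ centre ⌝
  star-spoke-centre i = trans (star-undirected ⌜ spoke i ⌝ ⌜ centre ⌝) (star-centre-spoke i)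

  star-leaf-spoke : ∀ i → Adj (subdividedStar k) ⌜ leaf i ⌝ ⌜ spoke i ⌝
  star-leaf-spoke i = trans (star-undirected ⌜ leaf i ⌝ ⌜ spoke i ⌝) (star-spoke-leaf i)

  starPlus : Vertex → Vertex → Graph (suc (k + k))
  starPlus X Y = addEdge (subdividedStar k) ⌜ X ⌝ ⌜ Y ⌝

  IOCodeMissing : Graph (suc (k + k)) → ℕ → Set
  IOCodeMissing G m = Σ (Subset (suc (k + k))) λ S → IsIOCode G S × m + ∣ S ∣ ≤ suc (k + k)

  record Signature (G : Graph (suc (k + k))) (S : Subset (suc (k + k))) : Set where
    field
      first second : Vertex → Vertex
      recover      : Vertex → Vertex → Vertex
      witnesses    : ∀ a → ⌜ first a ⌝ ∈ N G ⌜ a ⌝ ∩ S × ⌜ second a ⌝ ∈ N G ⌜ a ⌝ ∩ S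
      recovers     : ∀ a → recover (first a) (second a) ≡ a

  spokePair : Fin k → Fin k → Vertex
  spokePair i j with i ≟ j
  ... | yes _ = leaf i
  ... | no _  = centre

  spokePair-diag : ∀ i → spokePair i i ≡ leaf i
  spokePair-diag i with i ≟ i
  ... | yes _   = refl
  ... | no i≢i  = contradiction refl i≢i

  spokePair-≢ : ∀ {i j} → i ≢ j → spokePair i j ≡ centre
  spokePair-≢ {i} {j} i≢j with i ≟ j
  ... | yes i≡j = contradiction i≡j i≢j
  ... | no _    = refl

  ⌜⌝-≢ : ∀ {a b} → a ≢ b → ⌜ a ⌝ ≢ ⌜ b ⌝
  ⌜⌝-≢ a≢b = a≢b ∘ ⌜⌝-injective

  ⌜⌝∈⊤-⌜⌝ : ∀ {w r} → w ≢ r → ⌜ w ⌝ ∈ ⊤ - ⌜ r ⌝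
  ⌜⌝∈⊤-⌜⌝ w≢r = x∈p∧x≢y⇒x∈p-y ∈⊤ (⌜⌝-≢ w≢r)

  ⌜⌝∈⊤-⌜⌝-⌜⌝ : ∀ {w r r′} → w ≢ r → w ≢ r′ → ⌜ w ⌝ ∈ ⊤ - ⌜ r ⌝ - ⌜ r′ ⌝
  ⌜⌝∈⊤-⌜⌝-⌜⌝ w≢r w≢r′ = x∈p∧x≢y⇒x∈p-y (⌜⌝∈⊤-⌜⌝ w≢r) (⌜⌝-≢ w≢r′)

  module WithEdge (X Y : Vertex) where

    G : Graph (suc (k + k))
    G = starPlus X Y

    undirected : Undirected G
    undirected = addEdge-undirected {G = subdividedStar k} {⌜ X ⌝} {⌜ Y ⌝} star-undirected

    loopless : ⌜ X ⌝ ≢ ⌜ Y ⌝ → Loopless G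
    loopless = addEdge-loopless {G = subdividedStar k} {⌜ X ⌝} {⌜ Y ⌝} star-loopless

    star⊆G : ∀ {u v} → Adj (subdividedStar k) u v → Adj G u v
    star⊆G {u} {v} = addEdge-⊇ {G = subdividedStar k} {⌜ X ⌝} {⌜ Y ⌝} {u} {v}

    infix 4 _~_
    record _~_ (a b : Vertex) : Set where
      constructor edge
      field adjacent : Adj G ⌜ a ⌝ ⌜ b ⌝
    open _~_

    ~-sym : ∀ {a b} → a ~ b → b ~ a
    ~-sym {a} {b} (edge ab) = edge (adj-sym {G = G} undirected {⌜ a ⌝} {⌜ b ⌝} ab)

    centre~spoke : ∀ i → centre ~ spoke i
    centre~spoke i = edge (star⊆G {⌜ centre ⌝} {⌜ spoke i ⌝} (star-centre-spoke i))

    spoke~centre : ∀ i → spoke i ~ centre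
    spoke~centre i = ~-sym (centre~spoke i)

    spoke~leaf : ∀ i → spoke i ~ leaf i
    spoke~leaf i = edge (star⊆G {⌜ spoke i ⌝} {⌜ leaf i ⌝} (star-spoke-leaf i))

    leaf~spoke : ∀ i → leaf i ~ spoke i
    leaf~spoke i = ~-sym (spoke~leaf i)

    X~Y : X ~ Y
    X~Y = edge (addEdge-new {G = subdividedStar k} {⌜ X ⌝} {⌜ Y ⌝})

    Y~X : Y ~ X
    Y~X = ~-sym X~Y

    witness₁ : ∀ r {a w} → a ~ w → w ≢ r → ⌜ w ⌝ ∈ N G ⌜ a ⌝ ∩ (⊤ - ⌜ r ⌝)
    witness₁ r {a} {w} (edge aw) w≢r = ∈N∩⁺ {G = G} {⊤ - ⌜ r ⌝} {⌜ a ⌝} {⌜ w ⌝} aw (⌜⌝∈⊤-⌜⌝ w≢r)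

    witness₂ : ∀ r r′ {a w} → a ~ w → w ≢ r → w ≢ r′ → ⌜ w ⌝ ∈ N G ⌜ a ⌝ ∩ (⊤ - ⌜ r ⌝ - ⌜ r′ ⌝)
    witness₂ r r′ {a} {w} (edge aw) w≢r w≢r′ =
      ∈N∩⁺ {G = G} {⊤ - ⌜ r ⌝ - ⌜ r′ ⌝} {⌜ a ⌝} {⌜ w ⌝} aw (⌜⌝∈⊤-⌜⌝-⌜⌝ w≢r w≢r′)

    signature⇒IsIOCode : ⌜ X ⌝ ≢ ⌜ Y ⌝ → C4Free G → ∀ {S} → Signature G S → IsIOCode G S
    signature⇒IsIOCode X≢Y c4 {S} σ =
      pairedWitnesses⇒IsIOCode undirected (loopless X≢Y) c4
        (λ v → ⌜ first (label v) ⌝) (λ v → ⌜ second (label v) ⌝)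
        (λ v → subst (λ u → ⌜ first (label v) ⌝ ∈ N G u ∩ S) (⌜label⌝ v)
                     (proj₁ (witnesses (label v))))
        (λ v → subst (λ u → ⌜ second (label v) ⌝ ∈ N G u ∩ S) (⌜label⌝ v)
                     (proj₂ (witnesses (label v))))
        λ {u} {v} p≡ q≡ → begin
          u                              ≡⟨ sym (⌜label⌝ u) ⟩
          ⌜ label u ⌝                    ≡⟨ cong ⌜_⌝ (sym (recovers (label u))) ⟩
          ⌜ recover (first (label u)) (second (label u)) ⌝
            ≡⟨ cong ⌜_⌝ (cong₂ recover (⌜⌝-injective p≡) (⌜⌝-injective q≡)) ⟩
          ⌜ recover (first (label v)) (second (label v)) ⌝
            ≡⟨ cong ⌜_⌝ (recovers (label v)) ⟩
          ⌜ label v ⌝                    ≡⟨ ⌜label⌝ v ⟩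
          v                              ∎
      where
      open Signature σ
      open ≡-Reasoning

    centre-degree : ∀ {j} → centre ~ leaf j → suc k ≤ ∣ N G ⌜ centre ⌝ ∣
    centre-degree {j} centre~leaf = injection⇒≤∣p∣ neighbour neighbour-injective neighbour∈N
      where
      neighbour : Fin (suc k) → Fin (suc (k + k))
      neighbour zero    = ⌜ leaf j ⌝
      neighbour (suc i) = ⌜ spoke i ⌝

      neighbour-injective : Injective _≡_ _≡_ neighbour
      neighbour-injective {zero}  {zero}   _  = refl
      neighbour-injective {zero}  {suc i}  eq = contradiction (⌜⌝-injective {leaf j} {spoke i} eq) λ ()
      neighbour-injective {suc i} {zero}   eq = contradiction (⌜⌝-injective {spoke i} {leaf j} eq) λ ()
      neighbour-injective {suc i} {suc i′} eq =
        cong suc (spoke-injective (⌜⌝-injective {spoke i} {spoke i′} eq))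

      neighbour∈N : ∀ i → neighbour i ∈ N G ⌜ centre ⌝
      neighbour∈N zero    = ∈N⁺ {G = G} {⌜ centre ⌝} (adjacent centre~leaf)
      neighbour∈N (suc i) = ∈N⁺ {G = G} {⌜ centre ⌝} (adjacent (centre~spoke i))

    spoke-leaf-square : ⌜ X ⌝ ≢ ⌜ Y ⌝ → ∀ {i j} → i ≢ j → spoke i ~ leaf j → ¬ C4Free G
    spoke-leaf-square X≢Y {i} {j} i≢j spoke~leaf′ c4 =
      C4Free⇒¬square (loopless X≢Y) c4
        (⌜⌝-≢ {centre} {leaf j} λ ()) (⌜⌝-≢ {spoke i} {spoke j} (i≢j ∘ spoke-injective))
        (adjacent (centre~spoke i)) (adjacent spoke~leaf′) (adjacent (leaf~spoke j)) (adjacent (spoke~centre j))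

  module Wide (X Y : Vertex) (X≢Y : ⌜ X ⌝ ≢ ⌜ Y ⌝) {i₀ i₁ : Fin k} (i₀≢i₁ : i₀ ≢ i₁) where
    open WithEdge X Y

    first second : Vertex → Vertex
    first centre    = spoke i₀
    first (spoke i) = leaf i
    first (leaf i)  = spoke i
    second centre   = spoke i₁
    second a        = first a

    recover : Vertex → Vertex → Vertex
    recover (spoke i) (spoke j) = spokePair i j
    recover (leaf i)  _         = spoke i
    recover _         _         = centre

    S : Subset (suc (k + k))
    S = ⊤ - ⌜ centre ⌝

    kept : ∀ {a w} → a ~ w → w ≢ centre → ⌜ w ⌝ ∈ N G ⌜ a ⌝ ∩ S
    kept = witness₁ centre

    witnesses : ∀ a → ⌜ first a ⌝ ∈ N G ⌜ a ⌝ ∩ S × ⌜ second a ⌝ ∈ N G ⌜ a ⌝ ∩ S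
    witnesses centre    = kept (centre~spoke i₀) (λ ()) , kept (centre~spoke i₁) (λ ())
    witnesses (spoke i) = kept (spoke~leaf i) (λ ()) , kept (spoke~leaf i) (λ ())
    witnesses (leaf i)  = kept (leaf~spoke i) (λ ()) , kept (leaf~spoke i) (λ ())

    recovers : ∀ a → recover (first a) (second a) ≡ a
    recovers centre    = spokePair-≢ i₀≢i₁
    recovers (spoke i) = refl
    recovers (leaf i)  = spokePair-diag i

    signature : Signature G S
    signature = record
      { first = first ; second = second ; recover = recover ; witnesses = witnesses ; recovers = recovers }

    code : C4Free G → IOCodeMissing G 1
    code c4 = S , signature⇒IsIOCode X≢Y c4 signature , ∣⊤-x∣<n ⌜ centre ⌝

  module SpokeSpoke {I J : Fin k} (I≢J : I ≢ J) where
    open WithEdge (spoke I) (spoke J)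

    first second : Vertex → Vertex
    first centre    = spoke I
    first (spoke i) = centre
    first (leaf i)  = spoke i
    second centre   = spoke J
    second (spoke i) with i ≟ I | i ≟ J
    ... | yes _ | _     = spoke J
    ... | no _  | yes _ = spoke I
    ... | no _  | no _  = leaf i
    second (leaf i) = spoke i

    recover : Vertex → Vertex → Vertex
    recover (spoke i) (spoke j) = spokePair i j
    recover centre (spoke j) with j ≟ I
    ... | yes _ = spoke J
    ... | no _  = spoke I
    recover centre (leaf i) = spoke i
    recover _ _ = centre

    S : Subset (suc (k + k))
    S = ⊤ - ⌜ leaf I ⌝ - ⌜ leaf J ⌝

    kept : ∀ {a w} → a ~ w → w ≢ leaf I → w ≢ leaf J → ⌜ w ⌝ ∈ N G ⌜ a ⌝ ∩ S
    kept = witness₂ (leaf I) (leaf J)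

    witnesses : ∀ a → ⌜ first a ⌝ ∈ N G ⌜ a ⌝ ∩ S × ⌜ second a ⌝ ∈ N G ⌜ a ⌝ ∩ S
    witnesses centre = kept (centre~spoke I) (λ ()) (λ ()) , kept (centre~spoke J) (λ ()) (λ ())
    witnesses (spoke i) with i ≟ I | i ≟ J
    ... | yes refl | _        = kept (spoke~centre I) (λ ()) (λ ()) , kept X~Y (λ ()) (λ ())
    ... | no _     | yes refl = kept (spoke~centre J) (λ ()) (λ ()) , kept Y~X (λ ()) (λ ())
    ... | no i≢I   | no i≢J   =
      kept (spoke~centre i) (λ ()) (λ ()) ,
      kept (spoke~leaf i) (i≢I ∘ leaf-injective) (i≢J ∘ leaf-injective)
    witnesses (leaf i) = kept (leaf~spoke i) (λ ()) (λ ()) , kept (leaf~spoke i) (λ ()) (λ ())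

    recover-centre-I : recover centre (spoke I) ≡ spoke J
    recover-centre-I with I ≟ I
    ... | yes _  = refl
    ... | no I≢I = contradiction refl I≢I

    recover-centre-J : recover centre (spoke J) ≡ spoke I
    recover-centre-J with J ≟ I
    ... | yes J≡I = contradiction (sym J≡I) I≢J
    ... | no _    = refl

    recovers : ∀ a → recover (first a) (second a) ≡ a
    recovers centre = spokePair-≢ I≢J
    recovers (spoke i) with i ≟ I | i ≟ J
    ... | yes refl | _        = recover-centre-J
    ... | no _     | yes refl = recover-centre-I
    ... | no _     | no _     = refl
    recovers (leaf i) = spokePair-diag i

    signature : Signature G S
    signature = record
      { first = first ; second = second ; recover = recover ; witnesses = witnesses ; recovers = recovers }

    code : C4Free G → IOCodeMissing G 2
    code c4 = S , signature⇒IsIOCode X≢Y c4 signature , ∣⊤-x-y∣+2≤n (⌜⌝-≢ leafI≢leafJ)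
      where
      X≢Y : ⌜ spoke I ⌝ ≢ ⌜ spoke J ⌝
      X≢Y = ⌜⌝-≢ (I≢J ∘ spoke-injective)
      leafI≢leafJ : leaf I ≢ leaf J
      leafI≢leafJ = I≢J ∘ leaf-injective

  module LeafLeaf {I J M : Fin k} (I≢J : I ≢ J) (M≢I : M ≢ I) (M≢J : M ≢ J) where
    open WithEdge (leaf I) (leaf J)

    first second : Vertex → Vertex
    first centre    = spoke J
    first (spoke i) = centre
    first (leaf i) with i ≟ I
    ... | yes _ = leaf J
    ... | no _  = spoke i
    second centre   = spoke M
    second (spoke i) with i ≟ M
    ... | yes _ = centre
    ... | no _  = leaf i
    second (leaf i) with i ≟ I | i ≟ J
    ... | yes _ | _     = leaf J
    ... | no _  | yes _ = leaf I
    ... | no _  | no _  = spoke i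

    recover : Vertex → Vertex → Vertex
    recover centre    (leaf i)  = spoke i
    recover centre    _         = spoke M
    recover (spoke i) (spoke j) = spokePair i j
    recover (spoke _) (leaf _)  = leaf J
    recover (spoke _) centre    = centre
    recover (leaf _)  _         = leaf I

    S : Subset (suc (k + k))
    S = ⊤ - ⌜ spoke I ⌝ - ⌜ leaf M ⌝

    kept : ∀ {a w} → a ~ w → w ≢ spoke I → w ≢ leaf M → ⌜ w ⌝ ∈ N G ⌜ a ⌝ ∩ S
    kept = witness₂ (spoke I) (leaf M)

    witnesses : ∀ a → ⌜ first a ⌝ ∈ N G ⌜ a ⌝ ∩ S × ⌜ second a ⌝ ∈ N G ⌜ a ⌝ ∩ S
    witnesses centre =
      kept (centre~spoke J) (I≢J ∘ sym ∘ spoke-injective) (λ ()) ,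
      kept (centre~spoke M) (M≢I ∘ spoke-injective) (λ ())
    witnesses (spoke i) with i ≟ M
    ... | yes refl = kept (spoke~centre M) (λ ()) (λ ()) , kept (spoke~centre M) (λ ()) (λ ())
    ... | no i≢M   =
      kept (spoke~centre i) (λ ()) (λ ()) , kept (spoke~leaf i) (λ ()) (i≢M ∘ leaf-injective)
    witnesses (leaf i) with i ≟ I | i ≟ J
    ... | yes refl | _        =
      kept X~Y (λ ()) (M≢J ∘ sym ∘ leaf-injective) , kept X~Y (λ ()) (M≢J ∘ sym ∘ leaf-injective)
    ... | no _     | yes refl =
      kept (leaf~spoke J) (I≢J ∘ sym ∘ spoke-injective) (λ ()) , kept Y~X (λ ()) (M≢I ∘ sym ∘ leaf-injective)
    ... | no i≢I   | no _     =
      kept (leaf~spoke i) (i≢I ∘ spoke-injective) (λ ()) , kept (leaf~spoke i) (i≢I ∘ spoke-injective) (λ ())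

    recovers : ∀ a → recover (first a) (second a) ≡ a
    recovers centre = spokePair-≢ (M≢J ∘ sym)
    recovers (spoke i) with i ≟ M
    ... | yes refl = refl
    ... | no _     = refl
    recovers (leaf i) with i ≟ I | i ≟ J
    ... | yes refl | _        = refl
    ... | no _     | yes refl = refl
    ... | no _     | no _     = spokePair-diag i

    signature : Signature G S
    signature = record
      { first = first ; second = second ; recover = recover ; witnesses = witnesses ; recovers = recovers }

    code : C4Free G → IOCodeMissing G 2
    code c4 = S , signature⇒IsIOCode X≢Y c4 signature , ∣⊤-x-y∣+2≤n (⌜⌝-≢ {spoke I} {leaf M} λ ())
      where
      X≢Y : ⌜ leaf I ⌝ ≢ ⌜ leaf J ⌝
      X≢Y = ⌜⌝-≢ (I≢J ∘ leaf-injective)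

  wideCode : 2 ≤ k → ∀ X Y → ⌜ X ⌝ ≢ ⌜ Y ⌝ → C4Free (starPlus X Y) → IOCodeMissing (starPlus X Y) 1
  wideCode 2≤k X Y X≢Y = Wide.code X Y X≢Y (proj₂ (proj₂ (distinct-pair 2≤k)))

  -- With no room for the centre's degree to grow, the added edge must join two spokes or two leaves.
  tightCode : 3 ≤ k → ∀ X Y → ⌜ X ⌝ ≢ ⌜ Y ⌝ → subdividedStar k ⌜ X ⌝ ⌜ Y ⌝ ≡ false →
    C4Free (starPlus X Y) → (∀ v → ∣ N (starPlus X Y) v ∣ ≤ k) → IOCodeMissing (starPlus X Y) 2
  tightCode _ centre centre X≢Y _ _ _ = contradiction refl X≢Y
  tightCode _ centre (spoke j) _ X≁Y _ _ = contradiction (trans (sym X≁Y) (star-centre-spoke j)) λ ()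
  tightCode _ (spoke i) centre _ X≁Y _ _ = contradiction (trans (sym X≁Y) (star-spoke-centre i)) λ ()
  tightCode _ centre (leaf j) _ _ _ deg =
    contradiction (≤-trans (centre-degree X~Y) (deg ⌜ centre ⌝)) (n≮n k)
    where open WithEdge centre (leaf j)
  tightCode _ (leaf j) centre _ _ _ deg =
    contradiction (≤-trans (centre-degree Y~X) (deg ⌜ centre ⌝)) (n≮n k)
    where open WithEdge (leaf j) centre
  tightCode _ (spoke i) (spoke j) X≢Y _ c4 _ = SpokeSpoke.code (X≢Y ∘ cong ⌜_⌝ ∘ cong spoke) c4
  tightCode _ (spoke i) (leaf j) X≢Y X≁Y c4 _ with i ≟ j
  ... | yes refl = contradiction (trans (sym X≁Y) (star-spoke-leaf i)) λ ()
  ... | no i≢j   = contradiction c4 (spoke-leaf-square X≢Y i≢j X~Y)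
    where open WithEdge (spoke i) (leaf j)
  tightCode _ (leaf j) (spoke i) X≢Y X≁Y c4 _ with i ≟ j
  ... | yes refl = contradiction (trans (sym X≁Y) (star-leaf-spoke i)) λ ()
  ... | no i≢j   = contradiction c4 (spoke-leaf-square X≢Y i≢j Y~X)
    where open WithEdge (leaf j) (spoke i)
  tightCode 3≤k (leaf i) (leaf j) X≢Y _ c4 _ =
    let M , M≢i , M≢j = avoid-two 3≤k i j (X≢Y ∘ cong ⌜_⌝ ∘ cong leaf)
    in  LeafLeaf.code (X≢Y ∘ cong ⌜_⌝ ∘ cong leaf) M≢i M≢j c4

open SubdividedStar using (vertex; labelled; wideCode; tightCode)

2k+1≤2Δ : ∀ {k Δ} → k < Δ → suc (k + k) ≤ 2 * Δ * 1
2k+1≤2Δ {k} {Δ} k<Δ = begin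
  suc k + k  ≤⟨ +-mono-≤ k<Δ (<⇒≤ k<Δ) ⟩
  Δ + Δ      ≡⟨ double Δ ⟩
  2 * Δ * 1  ∎
  where
  open ≤-Reasoning
  double : ∀ Δ → Δ + Δ ≡ 2 * Δ * 1
  double = solve-∀

2k+1≤4Δ : ∀ {k Δ} → k ≤ Δ → 1 ≤ Δ → suc (k + k) ≤ 2 * Δ * 2
2k+1≤4Δ {k} {Δ} k≤Δ 1≤Δ = begin
  1 + (k + k)        ≤⟨ +-mono-≤ 1≤Δ (+-mono-≤ k≤Δ k≤Δ) ⟩
  Δ + (Δ + Δ)        ≤⟨ m≤m+n (Δ + (Δ + Δ)) Δ ⟩
  Δ + (Δ + Δ) + Δ    ≡⟨ quadruple Δ ⟩
  2 * Δ * 2          ∎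
  where
  open ≤-Reasoning
  quadruple : ∀ Δ → Δ + (Δ + Δ) + Δ ≡ 2 * Δ * 2
  quadruple = solve-∀

proposition3 : (Δ k : ℕ) → 3 ≤ Δ → 2 ≤ k → k ≤ Δ →
    (x y : Fin (suc (k + k))) → x ≢ y → subdividedStar k x y ≡ false →
    C4Free (addEdge (subdividedStar k) x y) →
    ((v : Fin (suc (k + k))) → ∣ N (addEdge (subdividedStar k) x y) v ∣ ≤ Δ) →
    Σ (Subset (suc (k + k))) (λ S →
      IsIOCode (addEdge (subdividedStar k) x y) S ×
      2 * Δ * ∣ S ∣ ≤ (2 * Δ ∸ 1) * suc (k + k))
proposition3 Δ k 3≤Δ 2≤k k≤Δ x y x≢y x≁y c4 deg with labelled k x | labelled k y | k <? Δ
... | vertex X | vertex Y | yes k<Δ =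
  let S , code , missing = wideCode k 2≤k X Y x≢y c4
  in  S , code , deficiency-bound {m = 1} {Δ = Δ} missing (2k+1≤2Δ k<Δ)
... | vertex X | vertex Y | no k≮Δ =
  let S , code , missing = tightCode k (≤-trans 3≤Δ Δ≤k) X Y x≢y x≁y c4 (λ v → ≤-trans (deg v) Δ≤k)
  in  S , code , deficiency-bound {m = 2} {Δ = Δ} missing (2k+1≤4Δ k≤Δ (≤-trans (s≤s z≤n) 3≤Δ))
  where
  Δ≤k : Δ ≤ k
  Δ≤k = ≮⇒≥ k≮Δ
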